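{- For every integer $k \geq 0$, $$B_k = (-1)^k \sum_{j=0}^{k} \sum_{i=j}^{k} \frac{j+1}{i+1}\, S_1(i+1,j+1)\, S_2(k,i).$$
   Context: $B_k = B_k(0)$ denotes the Bernoulli numbers, where the Bernoulli polynomials $B_k(x)$ are defined by $\frac{t e^{xt}}{e^t-1} = \sum_{k=0}^{\infty} B_k(x) \frac{t^k}{k!}$ for $|t|<2\pi$ (so $B_1 = -\tfrac12$). $S_1(n,j)$ denotes the signed Stirling numbers of the first kind, defined by $x(x-1)\cdots(x-n+1) = \sum_{j=0}^{n} S_1(n,j) x^j$. $S_2(k,i)$ denotes the Stirling numbers of the second kind (the number of partitions of a $k$-element set into $i$ nonempty blocks, with $S_2(0,0)=1$). -}

module Defs where

open import Data.Nat as ℕ using (ℕ; zero; suc)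
open import Data.Nat.Combinatorics using (_C_)
open import Data.Integer as ℤ using (ℤ; +_)
open import Data.Rational using (ℚ; 0ℚ; 1ℚ; _+_; _*_; -_; _/_)
open import Data.List using (List; []; _∷_; _∷ʳ_; length)
open import Data.Vec as Vec using (Vec; []; _∷_; lookup)
open import Data.Fin using (Fin; fromℕ)

sumTo : ℕ → (ℕ → ℚ) → ℚ
sumTo zero    f = f 0
sumTo (suc n) f = sumTo n f + f (suc n)

-- Σ_{i=a}^{b} f i  (empty, i.e. 0, when b < a)
sumFromTo : ℕ → ℕ → (ℕ → ℚ) → ℚ
sumFromTo a b f = go (suc b ℕ.∸ a)
  where
  go : ℕ → ℚ
  go zero    = 0ℚ
  go (suc m) = go m + f (a ℕ.+ m)

-- Signed Stirling numbers of the first kind: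
--   x(x-1)...(x-n+1) = Σ_j S1 n j x^j,
-- equivalently S1 0 0 = 1, S1 0 (j+1) = 0, S1 (n+1) 0 = 0,
--   S1 (n+1) (j+1) = S1 n j - n * S1 n (j+1)
-- (obtained by multiplying the falling factorial by (x - n)).
S₁ : ℕ → ℕ → ℤ
S₁ zero    zero    = + 1
S₁ zero    (suc j) = + 0
S₁ (suc n) zero    = + 0
S₁ (suc n) (suc j) = S₁ n j ℤ.- (+ n) ℤ.* S₁ n (suc j)

S₂ : ℕ → ℕ → ℕ
S₂ zero    zero    = 1
S₂ zero    (suc i) = 0
S₂ (suc k) zero    = 0
S₂ (suc k) (suc i) = suc i ℕ.* S₂ k (suc i) ℕ.+ S₂ k i

-- Bernoulli numbers B_k = B_k(0) with B_1 = -1/2, from t/(e^t - 1) = Σ B_k t^k/k!.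
-- Comparing coefficients of t^(m+1) in t = (e^t - 1) Σ B_k t^k / k! gives
--   B_0 = 1,  Σ_{j=0}^{m} C(m+1, j) B_j = 0  for m ≥ 1,
-- i.e. B_m = - 1/(m+1) Σ_{j=0}^{m-1} C(m+1,j) B_j.
-- bernoulliVec n = (B_0, ..., B_n)
private
  sumVec : ∀ {n} → (Fin n → ℚ) → ℚ
  sumVec {zero}  f = 0ℚ
  sumVec {suc n} f = f Data.Fin.zero + sumVec (λ i → f (Data.Fin.suc i))

  toℕ' : ∀ {n} → Fin n → ℕ
  toℕ' = Data.Fin.toℕ

  snoc : ∀ {n} → Vec ℚ n → ℚ → Vec ℚ (suc n)
  snoc []       x = x ∷ []
  snoc (y ∷ ys) x = y ∷ snoc ys x

bernoulliVec : (n : ℕ) → Vec ℚ (suc n)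
bernoulliVec zero    = 1ℚ ∷ []
bernoulliVec (suc m) =
  snoc prev
       (- ((+ 1 / (suc (suc m))) *
           sumVec (λ (j : Fin (suc m)) →
             ((+ (suc (suc m) C toℕ' j)) / 1) * lookup prev j)))
  where
  prev = bernoulliVec m

B : ℕ → ℚ
B n = lookup (bernoulliVec n) (fromℕ n)

-- Let B⁺ₖ be the double sum without its sign, so that the claim is Bₖ = (-1)ᵏ B⁺ₖ.  With θ = x d/dx one has
-- Σⱼ j S₁(n,j) xʲ = θ(x)ₙ and Σᵢ S₂(N,i) θ(x)ᵢ = N xᴺ, so the inner sum over j is θ(x)_{i+1}/(i+1) at x = 1.
-- Together with Σⱼ C(n,j) S₂(j,i) = S₂(n+1,i+1) this gives Σⱼ C(n,j) B⁺ⱼ = B⁺ₙ + n, the recurrence of the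
-- Bernoulli numbers with B₁ = +1/2.  As n = Σⱼ C(n,j) δ₁ⱼ, binomial inversion turns it into
-- Σⱼ C(n,j) (-1)ʲ B⁺ⱼ = (-1)ⁿ (B⁺ₙ - δ₁ₙ), which for n ≥ 2 is the recurrence defining Bₖ.

module Submission where

open import Defs
open import Data.Nat using (ℕ; suc; _^_)
open import Data.Integer using (+_; -[1+_])
open import Data.Rational using (ℚ; _*_; _/_)
open import Data.Integer using (ℤ)
open import Relation.Binary.PropositionalEquality using (_≡_)

import Data.Integer as ℤ
import Data.Integer.Properties as ℤP
open import Data.Integer.Tactic.RingSolver using () renaming (solve-∀ to ℤsolve-∀)
open import Data.Nat as ℕ using (zero; _<_; _≤_; z≤n; s≤s; _∸_)
import Data.Nat.Properties as ℕP
open import Data.Nat.Combinatorics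
  using (_C_; nCk+nC[k+1]≡[n+1]C[k+1]; k>n⇒nCk≡0; nCn≡1; nC1≡n; nCk≡nC[n∸k])
open import Data.Rational using (0ℚ; 1ℚ; _+_; -_; _-_; fromℚᵘ)
open import Data.Rational.Properties
  using (+-*-commutativeRing; _≟_; toℚᵘ-injective; toℚᵘ-homo-+; toℚᵘ-homo-*; toℚᵘ-homo‿-;
         toℚᵘ-fromℚᵘ; fromℚᵘ-cong; +-identityˡ; +-identityʳ; +-comm; +-assoc; *-zeroˡ; *-zeroʳ;
         *-identityˡ; *-identityʳ; *-assoc; *-comm; *-distribˡ-+; *-distribʳ-+; neg-distrib-+;
         neg-distribˡ-*; neg-distribʳ-*)
open import Data.Rational.Unnormalised as ℚᵘ using (mkℚᵘ; *≡*)
import Data.Rational.Unnormalised.Properties as ℚᵘP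
open import Data.Fin using (Fin; zero; suc; toℕ; fromℕ; inject₁)
open import Data.Fin.Properties using (toℕ<n; toℕ-inject₁; toℕ-fromℕ)
open import Data.Vec using (Vec; []; _∷_; _∷ʳ_; lookup)
open import Data.Sum using (inj₁; inj₂)
open import Relation.Nullary using (dec⇒maybe)
open import Relation.Binary.PropositionalEquality
  using (refl; sym; trans; cong; cong₂; module ≡-Reasoning)
open import Algebra.Bundles using (CommutativeRing; Semiring)
open import Algebra.Properties.Semiring.Sum (CommutativeRing.semiring +-*-commutativeRing)
  using (sum; sum-cong-≗; ∑-distrib-+; ∑-comm; *-distribˡ-sum; sum-init-last; sum-replicate-zero)
open import Algebra.Definitions.RawSemiring (Semiring.rawSemiring (CommutativeRing.semiring +-*-commutativeRing))
  using () renaming (_^_ to _^ℚ_)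
open import Tactic.RingSolver using (solve-∀)
import Tactic.RingSolver.Core.AlmostCommutativeRing as ACR

ℚ-ring : ACR.AlmostCommutativeRing _ _
ℚ-ring = ACR.fromCommutativeRing +-*-commutativeRing (λ x → dec⇒maybe (0ℚ ≟ x))

ℤ→ℚ : ℤ → ℚ
ℤ→ℚ a = a / 1

ℕ→ℚ : ℕ → ℚ
ℕ→ℚ n = ℤ→ℚ (+ n)

1/[1+_] : ℕ → ℚ
1/[1+ n ] = + 1 / suc n

-- `fromℚᵘ (mkℚᵘ n d)` is `n / suc d` by definition, so `ℤ→ℚ` inherits the homomorphism properties of `fromℚᵘ`.
fromℚᵘ-homo-+ : ∀ p q → fromℚᵘ (p ℚᵘ.+ q) ≡ fromℚᵘ p + fromℚᵘ q
fromℚᵘ-homo-+ p q = toℚᵘ-injective (ℚᵘP.≃-trans (toℚᵘ-fromℚᵘ (p ℚᵘ.+ q))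
  (ℚᵘP.≃-sym (ℚᵘP.≃-trans (toℚᵘ-homo-+ (fromℚᵘ p) (fromℚᵘ q))
                          (ℚᵘP.+-cong (toℚᵘ-fromℚᵘ p) (toℚᵘ-fromℚᵘ q)))))

fromℚᵘ-homo-* : ∀ p q → fromℚᵘ (p ℚᵘ.* q) ≡ fromℚᵘ p * fromℚᵘ q
fromℚᵘ-homo-* p q = toℚᵘ-injective (ℚᵘP.≃-trans (toℚᵘ-fromℚᵘ (p ℚᵘ.* q))
  (ℚᵘP.≃-sym (ℚᵘP.≃-trans (toℚᵘ-homo-* (fromℚᵘ p) (fromℚᵘ q))
                          (ℚᵘP.*-cong (toℚᵘ-fromℚᵘ p) (toℚᵘ-fromℚᵘ q)))))

fromℚᵘ-homo‿- : ∀ p → fromℚᵘ (ℚᵘ.- p) ≡ - fromℚᵘ p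
fromℚᵘ-homo‿- p = toℚᵘ-injective (ℚᵘP.≃-trans (toℚᵘ-fromℚᵘ (ℚᵘ.- p))
  (ℚᵘP.≃-sym (ℚᵘP.≃-trans (toℚᵘ-homo‿- (fromℚᵘ p)) (ℚᵘP.-‿cong (toℚᵘ-fromℚᵘ p)))))

ℤ→ℚ-+ : ∀ a b → ℤ→ℚ (a ℤ.+ b) ≡ ℤ→ℚ a + ℤ→ℚ b
ℤ→ℚ-+ a b = trans (fromℚᵘ-cong {mkℚᵘ (a ℤ.+ b) 0} {mkℚᵘ a 0 ℚᵘ.+ mkℚᵘ b 0} (*≡* (identity a b)))
                  (fromℚᵘ-homo-+ (mkℚᵘ a 0) (mkℚᵘ b 0))
  where
  identity : ∀ a b → (a ℤ.+ b) ℤ.* + 1 ≡ (a ℤ.* + 1 ℤ.+ b ℤ.* + 1) ℤ.* + 1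
  identity = ℤsolve-∀

ℤ→ℚ-* : ∀ a b → ℤ→ℚ (a ℤ.* b) ≡ ℤ→ℚ a * ℤ→ℚ b
ℤ→ℚ-* a b = fromℚᵘ-homo-* (mkℚᵘ a 0) (mkℚᵘ b 0)

ℤ→ℚ-neg : ∀ a → ℤ→ℚ (ℤ.- a) ≡ - ℤ→ℚ a
ℤ→ℚ-neg a = fromℚᵘ-homo‿- (mkℚᵘ a 0)

n/[1+d]≡n*1/[1+d] : ∀ n d → (+ n) / suc d ≡ ℕ→ℚ n * 1/[1+ d ]
n/[1+d]≡n*1/[1+d] n d =
  trans (fromℚᵘ-cong {mkℚᵘ (+ n) d} {mkℚᵘ (+ n) 0 ℚᵘ.* mkℚᵘ (+ 1) d} (*≡* (identity (+ n) (+ suc d))))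
        (fromℚᵘ-homo-* (mkℚᵘ (+ n) 0) (mkℚᵘ (+ 1) d))
  where
  identity : ∀ a e → a ℤ.* (+ 1 ℤ.* e) ≡ (a ℤ.* + 1) ℤ.* e
  identity = ℤsolve-∀

1/[1+n]*[1+n]≡1 : ∀ n → 1/[1+ n ] * ℕ→ℚ (suc n) ≡ 1ℚ
1/[1+n]*[1+n]≡1 n =
  trans (sym (fromℚᵘ-homo-* (mkℚᵘ (+ 1) n) (mkℚᵘ (+ suc n) 0)))
        (fromℚᵘ-cong {mkℚᵘ (+ 1) n ℚᵘ.* mkℚᵘ (+ suc n) 0} {mkℚᵘ (+ 1) 0} (*≡* (identity (+ suc n))))
  where
  identity : ∀ e → (+ 1 ℤ.* e) ℤ.* + 1 ≡ + 1 ℤ.* (e ℤ.* + 1)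
  identity = ℤsolve-∀

ℕ→ℚ-+ : ∀ m n → ℕ→ℚ (m ℕ.+ n) ≡ ℕ→ℚ m + ℕ→ℚ n
ℕ→ℚ-+ m n = ℤ→ℚ-+ (+ m) (+ n)

ℕ→ℚ-* : ∀ m n → ℕ→ℚ (m ℕ.* n) ≡ ℕ→ℚ m * ℕ→ℚ n
ℕ→ℚ-* m n = trans (cong ℤ→ℚ (ℤP.pos-* m n)) (ℤ→ℚ-* (+ m) (+ n))

∑< : ℕ → (ℕ → ℚ) → ℚ
∑< n f = sum (λ (i : Fin n) → f (toℕ i))

∑<-cong : ∀ n {f g : ℕ → ℚ} → (∀ i → i < n → f i ≡ g i) → ∑< n f ≡ ∑< n g
∑<-cong n f≗g = sum-cong-≗ {n} (λ i → f≗g (toℕ i) (toℕ<n i))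

∑<-+ : ∀ n f g → ∑< n (λ i → f i + g i) ≡ ∑< n f + ∑< n g
∑<-+ n f g = ∑-distrib-+ {n} (λ i → f (toℕ i)) (λ i → g (toℕ i))

∑<-*ˡ : ∀ n c f → c * ∑< n f ≡ ∑< n (λ i → c * f i)
∑<-*ˡ n c f = *-distribˡ-sum {n} c (λ i → f (toℕ i))

∑<-neg : ∀ n f → ∑< n (λ i → - f i) ≡ - ∑< n f
∑<-neg zero    f = refl
∑<-neg (suc n) f = trans (cong (λ s → - f 0 + s) (∑<-neg n (λ i → f (suc i)))) (sym (neg-distrib-+ (f 0) _))

∑<-comm : ∀ m n (f : ℕ → ℕ → ℚ) → ∑< m (λ i → ∑< n (f i)) ≡ ∑< n (λ j → ∑< m (λ i → f i j))
∑<-comm m n f = ∑-comm {m} {n} (λ i j → f (toℕ i) (toℕ j))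

∑<-zero : ∀ n {f} → (∀ i → i < n → f i ≡ 0ℚ) → ∑< n f ≡ 0ℚ
∑<-zero n vanish = trans (∑<-cong n vanish) (sum-replicate-zero n)

∑<-suc : ∀ n f → ∑< (suc n) f ≡ ∑< n f + f n
∑<-suc n f = begin
  ∑< (suc n) f
    ≡⟨ sum-init-last {n} (λ i → f (toℕ i)) ⟩
  sum {n} (λ i → f (toℕ (inject₁ i))) + f (toℕ (fromℕ n))
    ≡⟨ cong₂ _+_ (sum-cong-≗ {n} (λ i → cong f (toℕ-inject₁ i))) (cong f (toℕ-fromℕ n)) ⟩
  ∑< n f + f n
    ∎
  where open ≡-Reasoning

∑<-extend : ∀ {a m f} → a ≤ m → (∀ i → a ≤ i → f i ≡ 0ℚ) → ∑< m f ≡ ∑< a f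
∑<-extend {m = zero}  z≤n _ = refl
∑<-extend {a} {suc m} {f} a≤1+m vanish with ℕP.m≤n⇒m<n∨m≡n a≤1+m
... | inj₂ refl        = refl
... | inj₁ (s≤s a≤m) = begin
  ∑< (suc m) f    ≡⟨ ∑<-suc m f ⟩
  ∑< m f + f m    ≡⟨ cong₂ _+_ (∑<-extend a≤m vanish) (vanish m a≤m) ⟩
  ∑< a f + 0ℚ     ≡⟨ +-identityʳ _ ⟩
  ∑< a f          ∎
  where open ≡-Reasoning

∑<-shift : ∀ m f → f 0 ≡ 0ℚ → f m ≡ 0ℚ → ∑< m (λ i → f (suc i)) ≡ ∑< m f
∑<-shift m f f0≡0 fm≡0 = begin
  ∑< m (λ i → f (suc i))         ≡⟨ +-identityˡ _ ⟨
  0ℚ + ∑< m (λ i → f (suc i))    ≡⟨ cong (_+ ∑< m (λ i → f (suc i))) f0≡0 ⟨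
  ∑< (suc m) f                   ≡⟨ ∑<-suc m f ⟩
  ∑< m f + f m                   ≡⟨ cong (λ s → ∑< m f + s) fm≡0 ⟩
  ∑< m f + 0ℚ                    ≡⟨ +-identityʳ _ ⟩
  ∑< m f                         ∎
  where open ≡-Reasoning

∑<-linear : ∀ m a b f g → ∑< m (λ i → a * f i - b * g i) ≡ a * ∑< m f - b * ∑< m g
∑<-linear m a b f g = begin
  ∑< m (λ i → a * f i - b * g i)
    ≡⟨ ∑<-+ m (λ i → a * f i) (λ i → - (b * g i)) ⟩
  ∑< m (λ i → a * f i) + ∑< m (λ i → - (b * g i))
    ≡⟨ cong₂ _+_ (sym (∑<-*ˡ m a f)) (∑<-neg m (λ i → b * g i)) ⟩
  a * ∑< m f + - ∑< m (λ i → b * g i)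
    ≡⟨ cong (λ s → a * ∑< m f - s) (∑<-*ˡ m b g) ⟨
  a * ∑< m f - b * ∑< m g
    ∎
  where open ≡-Reasoning

S₁ℚ : ℕ → ℕ → ℚ
S₁ℚ n j = ℤ→ℚ (S₁ n j)

S₂ℚ : ℕ → ℕ → ℚ
S₂ℚ k i = ℕ→ℚ (S₂ k i)

Cℚ : ℕ → ℕ → ℚ
Cℚ n k = ℕ→ℚ (n C k)

S₁ℚ-suc : ∀ n j → S₁ℚ (suc n) (suc j) ≡ S₁ℚ n j - ℕ→ℚ n * S₁ℚ n (suc j)
S₁ℚ-suc n j = begin
  ℤ→ℚ (S₁ n j ℤ.- n*s)              ≡⟨ ℤ→ℚ-+ (S₁ n j) (ℤ.- n*s) ⟩
  S₁ℚ n j + ℤ→ℚ (ℤ.- n*s)           ≡⟨ cong (λ t → S₁ℚ n j + t) (ℤ→ℚ-neg n*s) ⟩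
  S₁ℚ n j - ℤ→ℚ n*s                 ≡⟨ cong (λ t → S₁ℚ n j - t) (ℤ→ℚ-* (+ n) (S₁ n (suc j))) ⟩
  S₁ℚ n j - ℕ→ℚ n * S₁ℚ n (suc j)   ∎
  where
  open ≡-Reasoning
  n*s = + n ℤ.* S₁ n (suc j)

S₁-vanish : ∀ {n j} → n < j → S₁ n j ≡ + 0
S₁-vanish {zero}  {suc j} _         = refl
S₁-vanish {suc n} {suc j} (s≤s n<j) rewrite S₁-vanish n<j | S₁-vanish (ℕP.m<n⇒m<1+n n<j) =
  trans (ℤP.+-identityˡ _) (cong ℤ.-_ (ℤP.*-zeroʳ (+ n)))

n*S₁ℚ[n,0]≡0 : ∀ n → ℕ→ℚ n * S₁ℚ n 0 ≡ 0ℚ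
n*S₁ℚ[n,0]≡0 zero    = *-zeroˡ 1ℚ
n*S₁ℚ[n,0]≡0 (suc n) = *-zeroʳ (ℕ→ℚ (suc n))

S₂ℚ-suc : ∀ k i → S₂ℚ (suc k) (suc i) ≡ ℕ→ℚ (suc i) * S₂ℚ k (suc i) + S₂ℚ k i
S₂ℚ-suc k i = trans (ℕ→ℚ-+ (suc i ℕ.* S₂ k (suc i)) (S₂ k i))
                    (cong (_+ S₂ℚ k i) (ℕ→ℚ-* (suc i) (S₂ k (suc i))))

S₂-vanish : ∀ {k i} → k < i → S₂ k i ≡ 0
S₂-vanish {zero}  {suc i} _         = refl
S₂-vanish {suc k} {suc i} (s≤s k<i) rewrite S₂-vanish k<i | S₂-vanish (ℕP.m<n⇒m<1+n k<i) =
  trans (ℕP.+-identityʳ (i ℕ.* 0)) (ℕP.*-zeroʳ i)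

Cℚ-pascal : ∀ n k → Cℚ (suc n) (suc k) ≡ Cℚ n k + Cℚ n (suc k)
Cℚ-pascal n k = trans (cong ℕ→ℚ (sym (nCk+nC[k+1]≡[n+1]C[k+1] n k))) (ℕ→ℚ-+ (n C k) (n C suc k))

Cℚ[1+n,n]≡1+n : ∀ n → Cℚ (suc n) n ≡ ℕ→ℚ (suc n)
Cℚ[1+n,n]≡1+n n = cong ℕ→ℚ (trans (nCk≡nC[n∸k] (ℕP.n≤1+n n))
                                  (trans (cong (suc n C_) (ℕP.m+n∸n≡m 1 n)) (nC1≡n (suc n))))

Cℚ-vanish : ∀ {n k} → n < k → Cℚ n k ≡ 0ℚ
Cℚ-vanish n<k = cong ℕ→ℚ (k>n⇒nCk≡0 n<k)

falling : ℚ → ℕ → ℚ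
falling x zero    = 1ℚ
falling x (suc n) = falling x n * (x - ℕ→ℚ n)

-- θ = x d/dx applied to the falling factorial, computed by the product rule.
θfalling : ℚ → ℕ → ℚ
θfalling x zero    = 0ℚ
θfalling x (suc n) = θfalling x n * (x - ℕ→ℚ n) + falling x n * x

1^n≡1 : ∀ n → 1ℚ ^ℚ n ≡ 1ℚ
1^n≡1 zero    = refl
1^n≡1 (suc n) = trans (*-identityˡ (1ℚ ^ℚ n)) (1^n≡1 n)

a+b≡c⇒b≡c-a : ∀ {a b c} → a + b ≡ c → b ≡ c - a
a+b≡c⇒b≡c-a {a} {b} refl = identity a b
  where
  identity : ∀ a b → b ≡ (a + b) - a
  identity = solve-∀ ℚ-ring

∑S₁x^j≡falling : ∀ x {n m} → n < m → ∑< m (λ j → S₁ℚ n j * x ^ℚ j) ≡ falling x n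
∑S₁x^j≡falling x {zero} {suc m} _ =
  cong (λ s → 1ℚ + s) (∑<-zero m (λ j _ → *-zeroˡ (x ^ℚ suc j)))
∑S₁x^j≡falling x {suc n} {suc m} (s≤s n<m) = begin
  0ℚ + ∑< m (λ j → S₁ℚ (suc n) (suc j) * x ^ℚ suc j)
    ≡⟨ +-identityˡ (∑< m (λ j → S₁ℚ (suc n) (suc j) * x ^ℚ suc j)) ⟩
  ∑< m (λ j → S₁ℚ (suc n) (suc j) * x ^ℚ suc j)
    ≡⟨ ∑<-cong m (λ j _ → trans (cong (_* x ^ℚ suc j) (S₁ℚ-suc n j))
                                (identity (S₁ℚ n j) (S₁ℚ n (suc j)) (ℕ→ℚ n) x (x ^ℚ j))) ⟩
  ∑< m (λ j → x * (S₁ℚ n j * x ^ℚ j) - ℕ→ℚ n * (S₁ℚ n (suc j) * x ^ℚ suc j))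
    ≡⟨ ∑<-linear m x (ℕ→ℚ n) (λ j → S₁ℚ n j * x ^ℚ j) (λ j → S₁ℚ n (suc j) * x ^ℚ suc j) ⟩
  x * ∑< m (λ j → S₁ℚ n j * x ^ℚ j) - ℕ→ℚ n * ∑< m (λ j → S₁ℚ n (suc j) * x ^ℚ suc j)
    ≡⟨ cong₂ (λ s t → x * s - ℕ→ℚ n * t) (∑S₁x^j≡falling x n<m)
             (a+b≡c⇒b≡c-a (∑S₁x^j≡falling x (ℕP.m<n⇒m<1+n n<m))) ⟩
  x * falling x n - ℕ→ℚ n * (falling x n - S₁ℚ n 0 * 1ℚ)
    ≡⟨ rearrange x (falling x n) (ℕ→ℚ n) (S₁ℚ n 0) ⟩
  falling x n * (x - ℕ→ℚ n) + ℕ→ℚ n * S₁ℚ n 0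
    ≡⟨ cong (λ s → falling x n * (x - ℕ→ℚ n) + s) (n*S₁ℚ[n,0]≡0 n) ⟩
  falling x n * (x - ℕ→ℚ n) + 0ℚ
    ≡⟨ +-identityʳ (falling x (suc n)) ⟩
  falling x (suc n)
    ∎
  where
  open ≡-Reasoning
  identity : ∀ a b c x y → (a - c * b) * (x * y) ≡ x * (a * y) - c * (b * (x * y))
  identity = solve-∀ ℚ-ring
  rearrange : ∀ x f c s → x * f - c * (f - s * 1ℚ) ≡ f * (x - c) + c * s
  rearrange = solve-∀ ℚ-ring

∑jS₁x^j≡θfalling : ∀ x {n m} → n < m → ∑< m (λ j → ℕ→ℚ j * (S₁ℚ n j * x ^ℚ j)) ≡ θfalling x n
∑jS₁x^j≡θfalling x {zero} {suc m} _ =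
  cong (λ s → 0ℚ + s)
       (∑<-zero m (λ j _ → trans (cong (ℕ→ℚ (suc j) *_) (*-zeroˡ (x ^ℚ suc j))) (*-zeroʳ (ℕ→ℚ (suc j)))))
∑jS₁x^j≡θfalling x {suc n} {suc m} (s≤s n<m) = begin
  0ℚ + ∑< m (λ j → ℕ→ℚ (suc j) * (S₁ℚ (suc n) (suc j) * x ^ℚ suc j))
    ≡⟨ +-identityˡ (∑< m (λ j → ℕ→ℚ (suc j) * (S₁ℚ (suc n) (suc j) * x ^ℚ suc j))) ⟩
  ∑< m (λ j → ℕ→ℚ (suc j) * (S₁ℚ (suc n) (suc j) * x ^ℚ suc j))
    ≡⟨ ∑<-cong m (λ j _ → expand j) ⟩
  ∑< m (λ j → x * (ℕ→ℚ j * (S₁ℚ n j * x ^ℚ j) + S₁ℚ n j * x ^ℚ j)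
              - ℕ→ℚ n * (ℕ→ℚ (suc j) * (S₁ℚ n (suc j) * x ^ℚ suc j)))
    ≡⟨ ∑<-linear m x (ℕ→ℚ n) (λ j → ℕ→ℚ j * (S₁ℚ n j * x ^ℚ j) + S₁ℚ n j * x ^ℚ j)
                              (λ j → ℕ→ℚ (suc j) * (S₁ℚ n (suc j) * x ^ℚ suc j)) ⟩
  x * ∑< m (λ j → ℕ→ℚ j * (S₁ℚ n j * x ^ℚ j) + S₁ℚ n j * x ^ℚ j)
    - ℕ→ℚ n * ∑< m (λ j → ℕ→ℚ (suc j) * (S₁ℚ n (suc j) * x ^ℚ suc j))
    ≡⟨ cong₂ (λ s t → x * s - ℕ→ℚ n * t)
             (trans (∑<-+ m (λ j → ℕ→ℚ j * (S₁ℚ n j * x ^ℚ j)) (λ j → S₁ℚ n j * x ^ℚ j))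
                    (cong₂ _+_ (∑jS₁x^j≡θfalling x n<m) (∑S₁x^j≡falling x n<m)))
             (a+b≡c⇒b≡c-a (∑jS₁x^j≡θfalling x (ℕP.m<n⇒m<1+n n<m))) ⟩
  x * (θfalling x n + falling x n) - ℕ→ℚ n * (θfalling x n - ℕ→ℚ 0 * (S₁ℚ n 0 * 1ℚ))
    ≡⟨ rearrange x (θfalling x n) (falling x n) (ℕ→ℚ n) (S₁ℚ n 0) ⟩
  θfalling x (suc n)
    ∎
  where
  open ≡-Reasoning
  identity : ∀ a b c x y j →
    (1ℚ + j) * ((a - c * b) * (x * y)) ≡ x * (j * (a * y) + a * y) - c * ((1ℚ + j) * (b * (x * y)))
  identity = solve-∀ ℚ-ring
  expand : ∀ j → ℕ→ℚ (suc j) * (S₁ℚ (suc n) (suc j) * x ^ℚ suc j)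
               ≡ x * (ℕ→ℚ j * (S₁ℚ n j * x ^ℚ j) + S₁ℚ n j * x ^ℚ j)
                 - ℕ→ℚ n * (ℕ→ℚ (suc j) * (S₁ℚ n (suc j) * x ^ℚ suc j))
  expand j rewrite ℕ→ℚ-+ 1 j | S₁ℚ-suc n j = identity (S₁ℚ n j) (S₁ℚ n (suc j)) (ℕ→ℚ n) x (x ^ℚ j) (ℕ→ℚ j)
  rearrange : ∀ x t f c s → x * (t + f) - c * (t - 0ℚ * (s * 1ℚ)) ≡ t * (x - c) + f * x
  rearrange = solve-∀ ℚ-ring

∑S₂-step : ∀ N m (g : ℕ → ℚ) → N < m →
  ∑< (suc m) (λ i → S₂ℚ (suc N) i * g i) ≡ ∑< m (λ i → S₂ℚ N i * (ℕ→ℚ i * g i + g (suc i)))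
∑S₂-step N m g N<m = begin
  0ℚ * g 0 + ∑< m (λ i → S₂ℚ (suc N) (suc i) * g (suc i))
    ≡⟨ cong₂ _+_ (*-zeroˡ (g 0)) (∑<-cong m (λ i _ → split i)) ⟩
  0ℚ + ∑< m (λ i → h (suc i) + S₂ℚ N i * g (suc i))
    ≡⟨ trans (+-identityˡ _) (∑<-+ m (λ i → h (suc i)) (λ i → S₂ℚ N i * g (suc i))) ⟩
  ∑< m (λ i → h (suc i)) + ∑< m (λ i → S₂ℚ N i * g (suc i))
    ≡⟨ cong (_+ ∑< m (λ i → S₂ℚ N i * g (suc i))) (∑<-shift m h h0≡0 hm≡0) ⟩
  ∑< m h + ∑< m (λ i → S₂ℚ N i * g (suc i))
    ≡⟨ sym (∑<-+ m h (λ i → S₂ℚ N i * g (suc i))) ⟩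
  ∑< m (λ i → h i + S₂ℚ N i * g (suc i))
    ≡⟨ ∑<-cong m (λ i _ → sym (*-distribˡ-+ (S₂ℚ N i) (ℕ→ℚ i * g i) (g (suc i)))) ⟩
  ∑< m (λ i → S₂ℚ N i * (ℕ→ℚ i * g i + g (suc i)))
    ∎
  where
  open ≡-Reasoning
  h : ℕ → ℚ
  h i = S₂ℚ N i * (ℕ→ℚ i * g i)
  h0≡0 : h 0 ≡ 0ℚ
  h0≡0 = trans (cong (S₂ℚ N 0 *_) (*-zeroˡ (g 0))) (*-zeroʳ (S₂ℚ N 0))
  hm≡0 : h m ≡ 0ℚ
  hm≡0 rewrite S₂-vanish N<m = *-zeroˡ (ℕ→ℚ m * g m)
  identity : ∀ c s t g → (c * s + t) * g ≡ s * (c * g) + t * g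
  identity = solve-∀ ℚ-ring
  split : ∀ i → S₂ℚ (suc N) (suc i) * g (suc i) ≡ h (suc i) + S₂ℚ N i * g (suc i)
  split i rewrite S₂ℚ-suc N i = identity (ℕ→ℚ (suc i)) (S₂ℚ N (suc i)) (S₂ℚ N i) (g (suc i))

∑S₂falling≡x^N : ∀ x {N m} → N < m → ∑< m (λ i → S₂ℚ N i * falling x i) ≡ x ^ℚ N
∑S₂falling≡x^N x {zero} {suc m} _ =
  cong (λ s → 1ℚ + s) (∑<-zero m (λ i _ → *-zeroˡ (falling x (suc i))))
∑S₂falling≡x^N x {suc N} {suc m} (s≤s N<m) = begin
  ∑< (suc m) (λ i → S₂ℚ (suc N) i * falling x i)
    ≡⟨ ∑S₂-step N m (falling x) N<m ⟩
  ∑< m (λ i → S₂ℚ N i * (ℕ→ℚ i * falling x i + falling x (suc i)))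
    ≡⟨ ∑<-cong m (λ i _ → identity (S₂ℚ N i) (ℕ→ℚ i) (falling x i) x) ⟩
  ∑< m (λ i → x * (S₂ℚ N i * falling x i))
    ≡⟨ sym (∑<-*ˡ m x (λ i → S₂ℚ N i * falling x i)) ⟩
  x * ∑< m (λ i → S₂ℚ N i * falling x i)
    ≡⟨ cong (x *_) (∑S₂falling≡x^N x N<m) ⟩
  x ^ℚ suc N
    ∎
  where
  open ≡-Reasoning
  identity : ∀ s c f x → s * (c * f + f * (x - c)) ≡ x * (s * f)
  identity = solve-∀ ℚ-ring

∑S₂θfalling≡Nx^N : ∀ x {N m} → N < m → ∑< m (λ i → S₂ℚ N i * θfalling x i) ≡ ℕ→ℚ N * x ^ℚ N
∑S₂θfalling≡Nx^N x {zero} {suc m} _ =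
  cong (λ s → 0ℚ + s) (∑<-zero m (λ i _ → *-zeroˡ (θfalling x (suc i))))
∑S₂θfalling≡Nx^N x {suc N} {suc m} (s≤s N<m) = begin
  ∑< (suc m) (λ i → S₂ℚ (suc N) i * θfalling x i)
    ≡⟨ ∑S₂-step N m (θfalling x) N<m ⟩
  ∑< m (λ i → S₂ℚ N i * (ℕ→ℚ i * θfalling x i + θfalling x (suc i)))
    ≡⟨ ∑<-cong m (λ i _ → identity (S₂ℚ N i) (ℕ→ℚ i) (θfalling x i) (falling x i) x) ⟩
  ∑< m (λ i → x * (S₂ℚ N i * θfalling x i) + x * (S₂ℚ N i * falling x i))
    ≡⟨ ∑<-+ m (λ i → x * (S₂ℚ N i * θfalling x i)) (λ i → x * (S₂ℚ N i * falling x i)) ⟩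
  ∑< m (λ i → x * (S₂ℚ N i * θfalling x i)) + ∑< m (λ i → x * (S₂ℚ N i * falling x i))
    ≡⟨ cong₂ _+_ (∑<-*ˡ m x (λ i → S₂ℚ N i * θfalling x i)) (∑<-*ˡ m x (λ i → S₂ℚ N i * falling x i)) ⟨
  x * ∑< m (λ i → S₂ℚ N i * θfalling x i) + x * ∑< m (λ i → S₂ℚ N i * falling x i)
    ≡⟨ cong₂ (λ s t → x * s + x * t) (∑S₂θfalling≡Nx^N x N<m) (∑S₂falling≡x^N x N<m) ⟩
  x * (ℕ→ℚ N * x ^ℚ N) + x * x ^ℚ N
    ≡⟨ rearrange x (ℕ→ℚ N) (x ^ℚ N) ⟩
  (1ℚ + ℕ→ℚ N) * x ^ℚ suc N
    ≡⟨ cong (_* x ^ℚ suc N) (sym (ℕ→ℚ-+ 1 N)) ⟩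
  ℕ→ℚ (suc N) * x ^ℚ suc N
    ∎
  where
  open ≡-Reasoning
  identity : ∀ s c t f x → s * (c * t + (t * (x - c) + f * x)) ≡ x * (s * t) + x * (s * f)
  identity = solve-∀ ℚ-ring
  rearrange : ∀ x n p → x * (n * p) + x * p ≡ (1ℚ + n) * (x * p)
  rearrange = solve-∀ ℚ-ring

binomialTransform : (ℕ → ℚ) → ℕ → ℚ
binomialTransform f n = ∑< (suc n) (λ j → Cℚ n j * f j)

module _ (n : ℕ) where

  binomialTransform-cong : ∀ {f g} → (∀ j → f j ≡ g j) → binomialTransform f n ≡ binomialTransform g n
  binomialTransform-cong f≗g = ∑<-cong (suc n) (λ j _ → cong (Cℚ n j *_) (f≗g j))

  binomialTransform-+ : ∀ f g →
    binomialTransform (λ j → f j + g j) n ≡ binomialTransform f n + binomialTransform g n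
  binomialTransform-+ f g = trans (∑<-cong (suc n) (λ j _ → *-distribˡ-+ (Cℚ n j) (f j) (g j)))
                                  (∑<-+ (suc n) (λ j → Cℚ n j * f j) (λ j → Cℚ n j * g j))

  binomialTransform-*ˡ : ∀ c f → binomialTransform (λ j → c * f j) n ≡ c * binomialTransform f n
  binomialTransform-*ˡ c f = trans (∑<-cong (suc n) (λ j _ → identity (Cℚ n j) c (f j)))
                                   (sym (∑<-*ˡ (suc n) c (λ j → Cℚ n j * f j)))
    where
    identity : ∀ a c x → a * (c * x) ≡ c * (a * x)
    identity = solve-∀ ℚ-ring

  binomialTransform-neg : ∀ f → binomialTransform (λ j → - f j) n ≡ - binomialTransform f n
  binomialTransform-neg f = trans (∑<-cong (suc n) (λ j _ → sym (neg-distribʳ-* (Cℚ n j) (f j))))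
                                  (∑<-neg (suc n) (λ j → Cℚ n j * f j))

binomialTransform-pascal : ∀ n f →
  binomialTransform f (suc n) ≡ binomialTransform f n + binomialTransform (λ j → f (suc j)) n
binomialTransform-pascal n f = begin
  -- `suc n C 0` computes to 1
  1ℚ * f 0 + ∑< (suc n) (λ j → Cℚ (suc n) (suc j) * f (suc j))
    ≡⟨ cong (λ s → 1ℚ * f 0 + s) (trans (∑<-cong (suc n) (λ j _ → pascal j))
                                        (∑<-+ (suc n) (λ j → Cℚ n j * f (suc j)) (λ j → Cℚ n (suc j) * f (suc j)))) ⟩
  1ℚ * f 0 + (binomialTransform (λ j → f (suc j)) n + upper)
    ≡⟨ +-assoc-middle (1ℚ * f 0) (binomialTransform (λ j → f (suc j)) n) upper ⟩
  (1ℚ * f 0 + upper) + binomialTransform (λ j → f (suc j)) n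
    ≡⟨ cong (_+ binomialTransform (λ j → f (suc j)) n) lower≡ ⟩
  binomialTransform f n + binomialTransform (λ j → f (suc j)) n
    ∎
  where
  open ≡-Reasoning
  upper : ℚ
  upper = ∑< (suc n) (λ j → Cℚ n (suc j) * f (suc j))
  pascal : ∀ j → Cℚ (suc n) (suc j) * f (suc j) ≡ Cℚ n j * f (suc j) + Cℚ n (suc j) * f (suc j)
  pascal j = trans (cong (_* f (suc j)) (Cℚ-pascal n j)) (*-distribʳ-+ (f (suc j)) (Cℚ n j) (Cℚ n (suc j)))
  +-assoc-middle : ∀ a b c → a + (b + c) ≡ (a + c) + b
  +-assoc-middle = solve-∀ ℚ-ring
  lower≡ : 1ℚ * f 0 + upper ≡ binomialTransform f n
  lower≡ = begin
    ∑< (suc (suc n)) (λ j → Cℚ n j * f j)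
      ≡⟨ ∑<-suc (suc n) (λ j → Cℚ n j * f j) ⟩
    binomialTransform f n + Cℚ n (suc n) * f (suc n)
      ≡⟨ cong (λ c → binomialTransform f n + c * f (suc n)) (Cℚ-vanish (ℕP.n<1+n n)) ⟩
    binomialTransform f n + 0ℚ * f (suc n)
      ≡⟨ cong (λ s → binomialTransform f n + s) (*-zeroˡ (f (suc n))) ⟩
    binomialTransform f n + 0ℚ
      ≡⟨ +-identityʳ (binomialTransform f n) ⟩
    binomialTransform f n
      ∎

sign : ℕ → ℚ
sign zero    = 1ℚ
sign (suc n) = - sign n

-- Induction on n for all f at once, splitting both the outer and the inner transform by Pascal's rule.
binomialTransform-inverse : ∀ n f →
  binomialTransform (λ j → sign j * binomialTransform f j) n ≡ sign n * f n
binomialTransform-inverse zero f = identity (f 0)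
  where
  identity : ∀ a → 1ℚ * (1ℚ * (1ℚ * a + 0ℚ)) + 0ℚ ≡ 1ℚ * a
  identity = solve-∀ ℚ-ring
binomialTransform-inverse (suc n) f = begin
  binomialTransform g (suc n)
    ≡⟨ binomialTransform-pascal n g ⟩
  binomialTransform g n + binomialTransform (λ j → g (suc j)) n
    ≡⟨ cong (λ s → binomialTransform g n + s) (binomialTransform-cong n g[1+j]) ⟩
  binomialTransform g n + binomialTransform (λ j → - g j + - g′ j) n
    ≡⟨ cong (λ s → binomialTransform g n + s)
            (trans (binomialTransform-+ n (λ j → - g j) (λ j → - g′ j))
                   (cong₂ _+_ (binomialTransform-neg n g) (binomialTransform-neg n g′))) ⟩
  binomialTransform g n + (- binomialTransform g n + - binomialTransform g′ n)
    ≡⟨ cancel (binomialTransform g n) (binomialTransform g′ n) ⟩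
  - binomialTransform g′ n
    ≡⟨ cong -_ (binomialTransform-inverse n (λ j → f (suc j))) ⟩
  - (sign n * f (suc n))
    ≡⟨ neg-distribˡ-* (sign n) (f (suc n)) ⟩
  sign (suc n) * f (suc n)
    ∎
  where
  open ≡-Reasoning
  g g′ : ℕ → ℚ
  g  j = sign j * binomialTransform f j
  g′ j = sign j * binomialTransform (λ i → f (suc i)) j
  identity : ∀ s a b → - s * (a + b) ≡ - (s * a) + - (s * b)
  identity = solve-∀ ℚ-ring
  g[1+j] : ∀ j → g (suc j) ≡ - g j + - g′ j
  g[1+j] j = trans (cong (- sign j *_) (binomialTransform-pascal j f))
                   (identity (sign j) (binomialTransform f j) (binomialTransform (λ i → f (suc i)) j))
  cancel : ∀ a b → a + (- a + - b) ≡ - b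
  cancel = solve-∀ ℚ-ring

binomialTransform-S₂ : ∀ n i → binomialTransform (λ j → S₂ℚ j i) n ≡ S₂ℚ (suc n) (suc i)
binomialTransform-S₂ zero i = trans (identity (S₂ℚ 0 i) (ℕ→ℚ (suc i))) (sym (S₂ℚ-suc 0 i))
  where
  identity : ∀ s c → 1ℚ * s + 0ℚ ≡ c * 0ℚ + s
  identity = solve-∀ ℚ-ring
binomialTransform-S₂ (suc n) i = begin
  binomialTransform (λ j → S₂ℚ j i) (suc n)
    ≡⟨ binomialTransform-pascal n (λ j → S₂ℚ j i) ⟩
  binomialTransform (λ j → S₂ℚ j i) n + binomialTransform (λ j → S₂ℚ (suc j) i) n
    ≡⟨ cong₂ _+_ (binomialTransform-S₂ n i) (shifted i) ⟩
  S₂ℚ (suc n) (suc i) + (ℕ→ℚ i * S₂ℚ (suc n) (suc i) + S₂ℚ (suc n) i)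
    ≡⟨ identity (S₂ℚ (suc n) (suc i)) (ℕ→ℚ i) (S₂ℚ (suc n) i) ⟩
  (1ℚ + ℕ→ℚ i) * S₂ℚ (suc n) (suc i) + S₂ℚ (suc n) i
    ≡⟨ cong (λ c → c * S₂ℚ (suc n) (suc i) + S₂ℚ (suc n) i) (sym (ℕ→ℚ-+ 1 i)) ⟩
  ℕ→ℚ (suc i) * S₂ℚ (suc n) (suc i) + S₂ℚ (suc n) i
    ≡⟨ sym (S₂ℚ-suc (suc n) i) ⟩
  S₂ℚ (suc (suc n)) (suc i)
    ∎
  where
  open ≡-Reasoning
  identity : ∀ s c t → s + (c * s + t) ≡ (1ℚ + c) * s + t
  identity = solve-∀ ℚ-ring
  shifted : ∀ i → binomialTransform (λ j → S₂ℚ (suc j) i) n ≡ ℕ→ℚ i * S₂ℚ (suc n) (suc i) + S₂ℚ (suc n) i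
  shifted zero = trans (∑<-zero (suc n) (λ j _ → *-zeroʳ (Cℚ n j))) (sym (identity′ (S₂ℚ (suc n) 1)))
    where
    identity′ : ∀ s → 0ℚ * s + 0ℚ ≡ 0ℚ
    identity′ = solve-∀ ℚ-ring
  shifted (suc i) = begin
    binomialTransform (λ j → S₂ℚ (suc j) (suc i)) n
      ≡⟨ binomialTransform-cong n (λ j → S₂ℚ-suc j i) ⟩
    binomialTransform (λ j → ℕ→ℚ (suc i) * S₂ℚ j (suc i) + S₂ℚ j i) n
      ≡⟨ binomialTransform-+ n (λ j → ℕ→ℚ (suc i) * S₂ℚ j (suc i)) (λ j → S₂ℚ j i) ⟩
    binomialTransform (λ j → ℕ→ℚ (suc i) * S₂ℚ j (suc i)) n + binomialTransform (λ j → S₂ℚ j i) n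
      ≡⟨ cong₂ _+_ (trans (binomialTransform-*ˡ n (ℕ→ℚ (suc i)) (λ j → S₂ℚ j (suc i)))
                          (cong (ℕ→ℚ (suc i) *_) (binomialTransform-S₂ n (suc i))))
                   (binomialTransform-S₂ n i) ⟩
    ℕ→ℚ (suc i) * S₂ℚ (suc n) (suc (suc i)) + S₂ℚ (suc n) (suc i)
      ∎

binomialTransform-∑S₂ : ∀ n (w : ℕ → ℚ) →
  binomialTransform (λ j → ∑< (suc j) (λ i → S₂ℚ j i * w i)) n ≡ ∑< (suc n) (λ i → S₂ℚ (suc n) (suc i) * w i)
binomialTransform-∑S₂ n w = begin
  ∑< (suc n) (λ j → Cℚ n j * ∑< (suc j) (λ i → S₂ℚ j i * w i))
    ≡⟨ ∑<-cong (suc n) (λ j j<1+n → cong (Cℚ n j *_) (sym (extend j<1+n))) ⟩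
  ∑< (suc n) (λ j → Cℚ n j * ∑< (suc n) (λ i → S₂ℚ j i * w i))
    ≡⟨ ∑<-cong (suc n) (λ j _ → ∑<-*ˡ (suc n) (Cℚ n j) (λ i → S₂ℚ j i * w i)) ⟩
  ∑< (suc n) (λ j → ∑< (suc n) (λ i → Cℚ n j * (S₂ℚ j i * w i)))
    ≡⟨ ∑<-comm (suc n) (suc n) (λ j i → Cℚ n j * (S₂ℚ j i * w i)) ⟩
  ∑< (suc n) (λ i → ∑< (suc n) (λ j → Cℚ n j * (S₂ℚ j i * w i)))
    ≡⟨ ∑<-cong (suc n) (λ i _ → collect i) ⟩
  ∑< (suc n) (λ i → S₂ℚ (suc n) (suc i) * w i)
    ∎
  where
  open ≡-Reasoning
  extend : ∀ {j} → j < suc n → ∑< (suc n) (λ i → S₂ℚ j i * w i) ≡ ∑< (suc j) (λ i → S₂ℚ j i * w i)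
  extend {j} j<1+n = ∑<-extend {f = λ i → S₂ℚ j i * w i} j<1+n
    (λ i j<i → trans (cong (λ s → ℕ→ℚ s * w i) (S₂-vanish j<i)) (*-zeroˡ (w i)))
  reassoc : ∀ c s e → c * (s * e) ≡ e * (c * s)
  reassoc = solve-∀ ℚ-ring
  collect : ∀ i → ∑< (suc n) (λ j → Cℚ n j * (S₂ℚ j i * w i)) ≡ S₂ℚ (suc n) (suc i) * w i
  collect i = begin
    ∑< (suc n) (λ j → Cℚ n j * (S₂ℚ j i * w i))  ≡⟨ ∑<-cong (suc n) (λ j _ → reassoc (Cℚ n j) (S₂ℚ j i) (w i)) ⟩
    ∑< (suc n) (λ j → w i * (Cℚ n j * S₂ℚ j i))  ≡⟨ sym (∑<-*ˡ (suc n) (w i) (λ j → Cℚ n j * S₂ℚ j i)) ⟩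
    w i * binomialTransform (λ j → S₂ℚ j i) n    ≡⟨ cong (w i *_) (binomialTransform-S₂ n i) ⟩
    w i * S₂ℚ (suc n) (suc i)                    ≡⟨ *-comm (w i) (S₂ℚ (suc n) (suc i)) ⟩
    S₂ℚ (suc n) (suc i) * w i                    ∎

∑S₂[n,1+i]θfalling≡n : ∀ n → ∑< (suc n) (λ i → S₂ℚ n (suc i) * θfalling 1ℚ (suc i)) ≡ ℕ→ℚ n
∑S₂[n,1+i]θfalling≡n n = begin
  ∑< (suc n) (λ i → S₂ℚ n (suc i) * θfalling 1ℚ (suc i))
    ≡⟨ +-identityˡ _ ⟨
  0ℚ + ∑< (suc n) (λ i → S₂ℚ n (suc i) * θfalling 1ℚ (suc i))
    ≡⟨ cong (λ s → s + ∑< (suc n) (λ i → S₂ℚ n (suc i) * θfalling 1ℚ (suc i))) (*-zeroʳ (S₂ℚ n 0)) ⟨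
  ∑< (suc (suc n)) (λ i → S₂ℚ n i * θfalling 1ℚ i)
    ≡⟨ ∑S₂θfalling≡Nx^N 1ℚ (ℕP.m<n⇒m<1+n (ℕP.n<1+n n)) ⟩
  ℕ→ℚ n * 1ℚ ^ℚ n
    ≡⟨ cong (ℕ→ℚ n *_) (1^n≡1 n) ⟩
  ℕ→ℚ n * 1ℚ
    ≡⟨ *-identityʳ (ℕ→ℚ n) ⟩
  ℕ→ℚ n
    ∎
  where open ≡-Reasoning

-- The inner sum Σⱼ (j+1)/(i+1) S₁(i+1, j+1) of the theorem: θ(x)_{i+1} at x = 1, divided by i + 1.
stirlingWeight : ℕ → ℚ
stirlingWeight i = 1/[1+ i ] * θfalling 1ℚ (suc i)

stirlingWeight*[1+i]≡θfalling : ∀ i → stirlingWeight i * ℕ→ℚ (suc i) ≡ θfalling 1ℚ (suc i)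
stirlingWeight*[1+i]≡θfalling i = begin
  (1/[1+ i ] * θfalling 1ℚ (suc i)) * ℕ→ℚ (suc i)  ≡⟨ rotate 1/[1+ i ] (θfalling 1ℚ (suc i)) (ℕ→ℚ (suc i)) ⟩
  θfalling 1ℚ (suc i) * (1/[1+ i ] * ℕ→ℚ (suc i))  ≡⟨ cong (θfalling 1ℚ (suc i) *_) (1/[1+n]*[1+n]≡1 i) ⟩
  θfalling 1ℚ (suc i) * 1ℚ                         ≡⟨ *-identityʳ (θfalling 1ℚ (suc i)) ⟩
  θfalling 1ℚ (suc i)                              ∎
  where
  open ≡-Reasoning
  rotate : ∀ a t c → (a * t) * c ≡ t * (a * c)
  rotate = solve-∀ ℚ-ring

-- The theorem's sum without the sign (-1)^k; it is the Bernoulli number with B₁ = +1/2.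
B⁺ : ℕ → ℚ
B⁺ k = ∑< (suc k) (λ i → S₂ℚ k i * stirlingWeight i)

B⁺-binomial : ∀ n → binomialTransform B⁺ n ≡ B⁺ n + ℕ→ℚ n
B⁺-binomial n = begin
  binomialTransform B⁺ n
    ≡⟨ binomialTransform-∑S₂ n stirlingWeight ⟩
  ∑< (suc n) (λ i → S₂ℚ (suc n) (suc i) * stirlingWeight i)
    ≡⟨ ∑<-cong (suc n) (λ i _ → split i) ⟩
  ∑< (suc n) (λ i → S₂ℚ n (suc i) * θfalling 1ℚ (suc i) + S₂ℚ n i * stirlingWeight i)
    ≡⟨ ∑<-+ (suc n) (λ i → S₂ℚ n (suc i) * θfalling 1ℚ (suc i)) (λ i → S₂ℚ n i * stirlingWeight i) ⟩
  ∑< (suc n) (λ i → S₂ℚ n (suc i) * θfalling 1ℚ (suc i)) + B⁺ n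
    ≡⟨ cong (_+ B⁺ n) (∑S₂[n,1+i]θfalling≡n n) ⟩
  ℕ→ℚ n + B⁺ n
    ≡⟨ +-comm (ℕ→ℚ n) (B⁺ n) ⟩
  B⁺ n + ℕ→ℚ n
    ∎
  where
  open ≡-Reasoning
  distribute : ∀ s c t e → (c * s + t) * e ≡ s * (e * c) + t * e
  distribute = solve-∀ ℚ-ring
  split : ∀ i → S₂ℚ (suc n) (suc i) * stirlingWeight i
              ≡ S₂ℚ n (suc i) * θfalling 1ℚ (suc i) + S₂ℚ n i * stirlingWeight i
  split i = begin
    S₂ℚ (suc n) (suc i) * stirlingWeight i
      ≡⟨ cong (_* stirlingWeight i) (S₂ℚ-suc n i) ⟩
    (ℕ→ℚ (suc i) * S₂ℚ n (suc i) + S₂ℚ n i) * stirlingWeight i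
      ≡⟨ distribute (S₂ℚ n (suc i)) (ℕ→ℚ (suc i)) (S₂ℚ n i) (stirlingWeight i) ⟩
    S₂ℚ n (suc i) * (stirlingWeight i * ℕ→ℚ (suc i)) + S₂ℚ n i * stirlingWeight i
      ≡⟨ cong (λ t → S₂ℚ n (suc i) * t + S₂ℚ n i * stirlingWeight i) (stirlingWeight*[1+i]≡θfalling i) ⟩
    S₂ℚ n (suc i) * θfalling 1ℚ (suc i) + S₂ℚ n i * stirlingWeight i
      ∎

δ₁ : ℕ → ℚ
δ₁ (suc zero) = 1ℚ
δ₁ _          = 0ℚ

binomialTransform-δ₁ : ∀ n → binomialTransform δ₁ n ≡ ℕ→ℚ n
binomialTransform-δ₁ zero    = refl
binomialTransform-δ₁ (suc n) = begin
  1ℚ * 0ℚ + (Cℚ (suc n) 1 * 1ℚ + ∑< n (λ j → Cℚ (suc n) (suc (suc j)) * 0ℚ))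
    ≡⟨ cong (λ s → 1ℚ * 0ℚ + (Cℚ (suc n) 1 * 1ℚ + s))
            (∑<-zero n (λ j _ → *-zeroʳ (Cℚ (suc n) (suc (suc j))))) ⟩
  1ℚ * 0ℚ + (Cℚ (suc n) 1 * 1ℚ + 0ℚ)
    ≡⟨ identity (Cℚ (suc n) 1) ⟩
  Cℚ (suc n) 1
    ≡⟨ cong ℕ→ℚ (nC1≡n (suc n)) ⟩
  ℕ→ℚ (suc n)
    ∎
  where
  open ≡-Reasoning
  identity : ∀ c → 1ℚ * 0ℚ + (c * 1ℚ + 0ℚ) ≡ c
  identity = solve-∀ ℚ-ring

B⁻ : ℕ → ℚ
B⁻ j = sign j * B⁺ j

-- By `B⁺-binomial` and `binomialTransform-δ₁`, B⁺ is the binomial transform of B⁺ - δ₁; invert it.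
B⁻-binomial : ∀ n → binomialTransform B⁻ n ≡ sign n * (B⁺ n - δ₁ n)
B⁻-binomial n = begin
  binomialTransform B⁻ n
    ≡⟨ binomialTransform-cong n (λ j → cong (sign j *_) (sym (binomialTransform-β j))) ⟩
  binomialTransform (λ j → sign j * binomialTransform β j) n
    ≡⟨ binomialTransform-inverse n β ⟩
  sign n * (B⁺ n - δ₁ n)
    ∎
  where
  open ≡-Reasoning
  β : ℕ → ℚ
  β j = B⁺ j - δ₁ j
  cancel : ∀ b k → (b + k) + - k ≡ b
  cancel = solve-∀ ℚ-ring
  binomialTransform-β : ∀ j → binomialTransform β j ≡ B⁺ j
  binomialTransform-β j = begin
    binomialTransform β j
      ≡⟨ binomialTransform-+ j B⁺ (λ i → - δ₁ i) ⟩
    binomialTransform B⁺ j + binomialTransform (λ i → - δ₁ i) j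
      ≡⟨ cong₂ _+_ (B⁺-binomial j) (trans (binomialTransform-neg j δ₁) (cong -_ (binomialTransform-δ₁ j))) ⟩
    (B⁺ j + ℕ→ℚ j) + - ℕ→ℚ j
      ≡⟨ cancel (B⁺ j) (ℕ→ℚ j) ⟩
    B⁺ j
      ∎

∑CB⁻≡0 : ∀ m → ∑< (suc (suc m)) (λ j → Cℚ (suc (suc m)) j * B⁻ j) ≡ 0ℚ
∑CB⁻≡0 m = begin
  S
    ≡⟨ identity₁ S d ⟩
  (S + 1ℚ * d) - d
    ≡⟨ cong (λ k → (S + ℕ→ℚ k * d) - d) (nCn≡1 (suc (suc m))) ⟨
  (S + Cℚ (suc (suc m)) (suc (suc m)) * d) - d
    ≡⟨ cong (_- d) (∑<-suc (suc (suc m)) (λ j → Cℚ (suc (suc m)) j * B⁻ j)) ⟨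
  binomialTransform B⁻ (suc (suc m)) - d
    ≡⟨ cong (_- d) (B⁻-binomial (suc (suc m))) ⟩
  sign (suc (suc m)) * (B⁺ (suc (suc m)) - 0ℚ) - d
    ≡⟨ identity₂ (sign (suc (suc m))) (B⁺ (suc (suc m))) ⟩
  0ℚ
    ∎
  where
  open ≡-Reasoning
  S = ∑< (suc (suc m)) (λ j → Cℚ (suc (suc m)) j * B⁻ j)
  d = B⁻ (suc (suc m))
  identity₁ : ∀ x d → x ≡ (x + 1ℚ * d) - d
  identity₁ = solve-∀ ℚ-ring
  identity₂ : ∀ s p → s * (p - 0ℚ) - s * p ≡ 0ℚ
  identity₂ = solve-∀ ℚ-ring

B⁻-recurrence : ∀ m → B⁻ (suc m) ≡ - (1/[1+ suc m ] * ∑< (suc m) (λ j → Cℚ (suc (suc m)) j * B⁻ j))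
B⁻-recurrence m = begin
  b                                  ≡⟨ identity₁ b a ⟨
  1ℚ * b + a * - 0ℚ                  ≡⟨ cong₂ (λ u v → u * b + a * - v) (sym a*c≡1) (sym S+cb≡0) ⟩
  (a * c) * b + a * - (S + c * b)    ≡⟨ identity₂ a b c S ⟩
  - (a * S)                          ∎
  where
  open ≡-Reasoning
  a = 1/[1+ suc m ]
  b = B⁻ (suc m)
  c = Cℚ (suc (suc m)) (suc m)
  S = ∑< (suc m) (λ j → Cℚ (suc (suc m)) j * B⁻ j)
  a*c≡1 : a * c ≡ 1ℚ
  a*c≡1 = trans (cong (a *_) (Cℚ[1+n,n]≡1+n (suc m))) (1/[1+n]*[1+n]≡1 (suc m))
  S+cb≡0 : S + c * b ≡ 0ℚ
  S+cb≡0 = trans (sym (∑<-suc (suc m) (λ j → Cℚ (suc (suc m)) j * B⁻ j))) (∑CB⁻≡0 m)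
  identity₁ : ∀ b a → 1ℚ * b + a * - 0ℚ ≡ b
  identity₁ = solve-∀ ℚ-ring
  identity₂ : ∀ a b c S → (a * c) * b + a * - (S + c * b) ≡ - (a * S)
  identity₂ = solve-∀ ℚ-ring

lookup-∷ʳ : ∀ {A : Set} {n} (v : Vec A n) x (P : ℕ → A) → (∀ i → lookup v i ≡ P (toℕ i)) → x ≡ P n →
            ∀ j → lookup (v ∷ʳ x) j ≡ P (toℕ j)
lookup-∷ʳ []       x P _      x≡Pn zero    = x≡Pn
lookup-∷ʳ (y ∷ ys) x P lookup≗ _    zero    = lookup≗ zero
lookup-∷ʳ (y ∷ ys) x P lookup≗ x≡Pn (suc j) = lookup-∷ʳ ys x (λ i → P (suc i)) (λ i → lookup≗ (suc i)) x≡Pn j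

-- `bernoulliVec` appends with the private helpers `snoc` and `sumVec` of Defs, which cannot be named here.
-- This lemma holds for any functions with their defining equations; `bernoulliVec-suc` applies it after
-- abstracting every argument of those helpers, so that unification can supply them.
append≡∷ʳ :
  (append : (m : ℕ) (κ : ℚ) (G : Fin m → ℚ) (h : ℚ) (n : ℕ) → Vec ℚ n → Vec ℚ (suc n))
  (total : (m : ℕ) → (Fin m → ℚ) → ℚ) →
  (∀ m κ G h → append m κ G h 0 [] ≡ (- (κ * (h + total m G))) ∷ []) →
  (∀ m κ G h n y (ys : Vec ℚ n) → append m κ G h (suc n) (y ∷ ys) ≡ y ∷ append m κ G h n ys) →
  (∀ G → total 0 G ≡ 0ℚ) →
  (∀ m G → total (suc m) G ≡ G zero + total m (λ i → G (suc i))) →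
  ∀ m κ G h n (v : Vec ℚ n) → append m κ G h n v ≡ v ∷ʳ (- (κ * (h + sum G)))
append≡∷ʳ append total append-[] append-∷ total-0 total-suc m κ G h zero [] =
  trans (append-[] m κ G h) (cong (λ s → (- (κ * (h + s))) ∷ []) (total≡sum m G))
  where
  total≡sum : ∀ m G → total m G ≡ sum G
  total≡sum zero    G = total-0 G
  total≡sum (suc m) G = trans (total-suc m G) (cong (λ s → G zero + s) (total≡sum m (λ i → G (suc i))))
append≡∷ʳ append total append-[] append-∷ total-0 total-suc m κ G h (suc n) (y ∷ ys) =
  trans (append-∷ m κ G h n y ys)
        (cong (y ∷_) (append≡∷ʳ append total append-[] append-∷ total-0 total-suc m κ G h n ys))

bernoulliNext : ℕ → ℚ
bernoulliNext m = - (1/[1+ suc m ] * sum (λ (j : Fin (suc m)) → Cℚ (suc (suc m)) (toℕ j) * lookup (bernoulliVec m) j))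

bernoulliVec-suc : ∀ m → bernoulliVec (suc m) ≡ bernoulliVec m ∷ʳ bernoulliNext m
bernoulliVec-suc =
  instantiate (append≡∷ʳ _ _ (λ _ _ _ _ → refl) (λ _ _ _ _ _ _ _ → refl) (λ _ → refl) (λ _ _ → refl))
  where
  instantiate : ((m : ℕ) (κ : ℚ) (G : Fin m → ℚ) (h : ℚ) (n : ℕ) (v : Vec ℚ n) → _) →
                ∀ m → bernoulliVec (suc m) ≡ bernoulliVec m ∷ʳ bernoulliNext m
  instantiate H m with 1/[1+ suc m ]
                     | (λ (i : Fin m) → Cℚ (suc (suc m)) (suc (toℕ i)) * lookup (bernoulliVec m) (suc i))
                     | Cℚ (suc (suc m)) 0 * lookup (bernoulliVec m) zero
  ... | κ | G | h with suc m | bernoulliVec m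
  ... | n | v = H m κ G h n v

lookup-bernoulliVec : ∀ m (j : Fin (suc m)) → lookup (bernoulliVec m) j ≡ B⁻ (toℕ j)
lookup-bernoulliVec zero    zero = refl
lookup-bernoulliVec (suc m) j    =
  trans (cong (λ w → lookup w j) (bernoulliVec-suc m))
        (lookup-∷ʳ (bernoulliVec m) (bernoulliNext m) B⁻ (lookup-bernoulliVec m) next≡B⁻ j)
  where
  next≡B⁻ : bernoulliNext m ≡ B⁻ (suc m)
  next≡B⁻ = trans (cong (λ s → - (1/[1+ suc m ] * s))
                        (sum-cong-≗ {suc m} (λ j → cong (Cℚ (suc (suc m)) (toℕ j) *_) (lookup-bernoulliVec m j))))
                  (sym (B⁻-recurrence m))

B≡B⁻ : ∀ k → B k ≡ B⁻ k
B≡B⁻ k = trans (lookup-bernoulliVec k (fromℕ k)) (cong B⁻ (toℕ-fromℕ k))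

ℤ→ℚ-[-1]^ : ∀ k → ℤ→ℚ (Data.Integer._^_ -[1+ 0 ] k) ≡ sign k
ℤ→ℚ-[-1]^ zero    = refl
ℤ→ℚ-[-1]^ (suc k) = begin
  ℤ→ℚ (-[1+ 0 ] ℤ.* Data.Integer._^_ -[1+ 0 ] k)   ≡⟨ ℤ→ℚ-* -[1+ 0 ] (Data.Integer._^_ -[1+ 0 ] k) ⟩
  - 1ℚ * ℤ→ℚ (Data.Integer._^_ -[1+ 0 ] k)         ≡⟨ cong (- 1ℚ *_) (ℤ→ℚ-[-1]^ k) ⟩
  - 1ℚ * sign k                                    ≡⟨ identity (sign k) ⟩
  - sign k                                         ∎
  where
  open ≡-Reasoning
  identity : ∀ s → - 1ℚ * s ≡ - s
  identity = solve-∀ ℚ-ring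

sumTo≡∑< : ∀ k f → sumTo k f ≡ ∑< (suc k) f
sumTo≡∑< zero    f = sym (+-identityʳ (f 0))
sumTo≡∑< (suc k) f = trans (cong (_+ f (suc k)) (sumTo≡∑< k f)) (sym (∑<-suc (suc k) f))

∑<-split : ∀ a c f → ∑< (a ℕ.+ c) f ≡ ∑< a f + ∑< c (λ t → f (a ℕ.+ t))
∑<-split zero    c f = sym (+-identityˡ (∑< c f))
∑<-split (suc a) c f = trans (cong (λ s → f 0 + s) (∑<-split a c (λ i → f (suc i))))
                             (sym (+-assoc (f 0) (∑< a (λ i → f (suc i))) _))

-- The accumulator of `sumFromTo` is private to Defs; as for `bernoulliVec`, it is supplied by unification.
accumulator≡∑< : ∀ a (f : ℕ → ℚ) (go : ℕ → ℚ) → go 0 ≡ 0ℚ → (∀ c → go (suc c) ≡ go c + f (a ℕ.+ c)) →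
                 ∀ c → go c ≡ ∑< c (λ t → f (a ℕ.+ t))
accumulator≡∑< a f go go-0 go-suc zero    = go-0
accumulator≡∑< a f go go-0 go-suc (suc c) =
  trans (go-suc c) (trans (cong (_+ f (a ℕ.+ c)) (accumulator≡∑< a f go go-0 go-suc c))
                          (sym (∑<-suc c (λ t → f (a ℕ.+ t)))))

sumFromTo≡∑< : ∀ a b f → sumFromTo a b f ≡ ∑< (suc b ∸ a) (λ t → f (a ℕ.+ t))
sumFromTo≡∑< a b f = instantiate (accumulator≡∑< a f _ refl (λ _ → refl))
  where
  instantiate : (∀ c → _) → sumFromTo a b f ≡ ∑< (suc b ∸ a) (λ t → f (a ℕ.+ t))
  instantiate H with suc b ∸ a
  ... | c = H c

sumFromTo≡∑<-zero-below : ∀ {a b} f → a ≤ b → (∀ i → i < a → f i ≡ 0ℚ) → sumFromTo a b f ≡ ∑< (suc b) f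
sumFromTo≡∑<-zero-below {a} {b} f a≤b vanish = begin
  sumFromTo a b f                      ≡⟨ sumFromTo≡∑< a b f ⟩
  ∑< c (λ t → f (a ℕ.+ t))             ≡⟨ +-identityˡ _ ⟨
  0ℚ + ∑< c (λ t → f (a ℕ.+ t))        ≡⟨ cong (_+ ∑< c (λ t → f (a ℕ.+ t))) (∑<-zero a vanish) ⟨
  ∑< a f + ∑< c (λ t → f (a ℕ.+ t))    ≡⟨ ∑<-split a c f ⟨
  ∑< (a ℕ.+ c) f                       ≡⟨ cong (λ n → ∑< n f) (ℕP.m+[n∸m]≡n (ℕP.m≤n⇒m≤1+n a≤b)) ⟩
  ∑< (suc b) f                         ∎
  where
  open ≡-Reasoning
  c = suc b ∸ a

summand : ℕ → ℕ → ℕ → ℚ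
summand k i j = ((+ suc j) / suc i) * ((S₁ (suc i) (suc j)) / 1) * ((+ S₂ k i) / 1)

-- The factor 1 ^ (j+1) matches the shape of `∑jS₁x^j≡θfalling` at x = 1.
summand-factorised : ∀ k i j →
  summand k i j ≡ (S₂ℚ k i * 1/[1+ i ]) * (ℕ→ℚ (suc j) * (S₁ℚ (suc i) (suc j) * 1ℚ ^ℚ suc j))
summand-factorised k i j = begin
  summand k i j
    ≡⟨ cong (λ u → u * S₁ℚ (suc i) (suc j) * S₂ℚ k i) (n/[1+d]≡n*1/[1+d] (suc j) i) ⟩
  (ℕ→ℚ (suc j) * 1/[1+ i ]) * S₁ℚ (suc i) (suc j) * S₂ℚ k i
    ≡⟨ regroup (ℕ→ℚ (suc j)) 1/[1+ i ] (S₁ℚ (suc i) (suc j)) (S₂ℚ k i) ⟩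
  (S₂ℚ k i * 1/[1+ i ]) * (ℕ→ℚ (suc j) * (S₁ℚ (suc i) (suc j) * 1ℚ))
    ≡⟨ cong (λ p → (S₂ℚ k i * 1/[1+ i ]) * (ℕ→ℚ (suc j) * (S₁ℚ (suc i) (suc j) * p))) (1^n≡1 (suc j)) ⟨
  (S₂ℚ k i * 1/[1+ i ]) * (ℕ→ℚ (suc j) * (S₁ℚ (suc i) (suc j) * 1ℚ ^ℚ suc j))
    ∎
  where
  open ≡-Reasoning
  regroup : ∀ c a s t → (c * a) * s * t ≡ (t * a) * (c * (s * 1ℚ))
  regroup = solve-∀ ℚ-ring

summand-vanish : ∀ k {i j} → i < j → summand k i j ≡ 0ℚ
summand-vanish k {i} {j} i<j = begin
  summand k i j
    ≡⟨ summand-factorised k i j ⟩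
  (S₂ℚ k i * 1/[1+ i ]) * (ℕ→ℚ (suc j) * (ℤ→ℚ (S₁ (suc i) (suc j)) * 1ℚ ^ℚ suc j))
    ≡⟨ cong (λ s → (S₂ℚ k i * 1/[1+ i ]) * (ℕ→ℚ (suc j) * (ℤ→ℚ s * 1ℚ ^ℚ suc j))) (S₁-vanish (s≤s i<j)) ⟩
  (S₂ℚ k i * 1/[1+ i ]) * (ℕ→ℚ (suc j) * (0ℚ * 1ℚ ^ℚ suc j))
    ≡⟨ annihilate (S₂ℚ k i * 1/[1+ i ]) (ℕ→ℚ (suc j)) (1ℚ ^ℚ suc j) ⟩
  0ℚ
    ∎
  where
  open ≡-Reasoning
  annihilate : ∀ a c p → a * (c * (0ℚ * p)) ≡ 0ℚ
  annihilate = solve-∀ ℚ-ring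

∑summand≡S₂*stirlingWeight : ∀ k {i} → i < suc k → ∑< (suc k) (summand k i) ≡ S₂ℚ k i * stirlingWeight i
∑summand≡S₂*stirlingWeight k {i} i<1+k = begin
  ∑< (suc k) (summand k i)
    ≡⟨ ∑<-cong (suc k) (λ j _ → summand-factorised k i j) ⟩
  ∑< (suc k) (λ j → c * jS₁ (suc j))
    ≡⟨ ∑<-*ˡ (suc k) c (λ j → jS₁ (suc j)) ⟨
  c * ∑< (suc k) (λ j → jS₁ (suc j))
    ≡⟨ cong (c *_) (trans (sym (+-identityˡ _)) (∑jS₁x^j≡θfalling 1ℚ (s≤s i<1+k))) ⟩
  c * θfalling 1ℚ (suc i)
    ≡⟨ *-assoc (S₂ℚ k i) 1/[1+ i ] (θfalling 1ℚ (suc i)) ⟩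
  S₂ℚ k i * stirlingWeight i
    ∎
  where
  open ≡-Reasoning
  c = S₂ℚ k i * 1/[1+ i ]
  jS₁ : ℕ → ℚ
  jS₁ j = ℕ→ℚ j * (S₁ℚ (suc i) j * 1ℚ ^ℚ j)

doubleSum≡B⁺ : ∀ k → sumTo k (λ j → sumFromTo j k (λ i → summand k i j)) ≡ B⁺ k
doubleSum≡B⁺ k = begin
  sumTo k (λ j → sumFromTo j k (λ i → summand k i j))
    ≡⟨ sumTo≡∑< k (λ j → sumFromTo j k (λ i → summand k i j)) ⟩
  ∑< (suc k) (λ j → sumFromTo j k (λ i → summand k i j))
    ≡⟨ ∑<-cong (suc k) (λ j j<1+k → sumFromTo≡∑<-zero-below (λ i → summand k i j) (ℕP.m<1+n⇒m≤n j<1+k)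
                                                             (λ i i<j → summand-vanish k i<j)) ⟩
  ∑< (suc k) (λ j → ∑< (suc k) (λ i → summand k i j))
    ≡⟨ ∑<-comm (suc k) (suc k) (λ j i → summand k i j) ⟩
  ∑< (suc k) (λ i → ∑< (suc k) (summand k i))
    ≡⟨ ∑<-cong (suc k) (λ i i<1+k → ∑summand≡S₂*stirlingWeight k i<1+k) ⟩
  B⁺ k
    ∎
  where open ≡-Reasoning

mainTheorem3 : (k : ℕ) →
    B k ≡ ((Data.Integer._^_ -[1+ 0 ] k) / 1) *
      sumTo k (λ j → sumFromTo j k (λ i →
        ((+ suc j) / suc i) * ((S₁ (suc i) (suc j)) / 1) * ((+ S₂ k i) / 1)))
mainTheorem3 k = trans (B≡B⁻ k) (sym (cong₂ _*_ (ℤ→ℚ-[-1]^ k) (doubleSum≡B⁺ k)))
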